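{- Let $t\leq n$ be positive integers and let $L=\{1^{a_1},2^{a_2},\ldots,t^{a_t}\}$ be a list with $|L|=a_1+\cdots+a_t=n$, such that $a_i\geq a_{i+1}\geq 1$ for all $i\in[1,t-1]$, $a_t\ge 1$, and $a_{4k+2}=a_{4k+3}=a_{4k+4}$ for every integer $k\geq 0$, where $a_i:=0$ for $i>t$. Then there exists a perfect matching $F$ of $K_{2n}$ such that $\ell(F)=\ell'(F)=L$.
   Context: For a positive integer $v$, $K_v$ denotes the complete graph on the vertex set $\{0,1,\ldots,v-1\}$. The length of an edge $\{u,w\}$ of $K_v$ is $\ell(u,w)=\min(|u-w|,\,v-|u-w|)$, and $\ell'(u,w)=|u-w|$. For a subgraph $\Gamma$ of $K_v$, $\ell(\Gamma)$ (resp. $\ell'(\Gamma)$) is the list (multiset) of the values $\ell(e)$ (resp. $\ell'(e)$) over all edges $e$ of $\Gamma$, counted with multiplicity. A perfect matching of $K_{2n}$ is a set of $n$ pairwise disjoint edges covering all vertices. The notation $\{1^{a_1},\ldots,t^{a_t}\}$ denotes the list containing $a_i$ copies of $i$. -}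

module Defs where

open import Data.Nat using (ℕ; zero; suc; _+_; _*_; _∸_; _<_; _⊓_)
open import Data.Nat.Properties using ()
open import Data.Product using (_×_; _,_; proj₁; proj₂)
open import Data.List using (List; []; _∷_; map; concatMap; replicate; upTo; length; applyUpTo)
open import Data.List.Relation.Unary.All using (All)
open import Data.List.Relation.Binary.Permutation.Propositional using (_↭_)

-- An edge {u,w} of K_v is represented by the ordered pair (u , w) with u < w.
Edge : Set
Edge = ℕ × ℕ

len' : Edge → ℕ
len' (u , w) = w ∸ u

len : ℕ → Edge → ℕ
len v (u , w) = (w ∸ u) ⊓ (v ∸ (w ∸ u))

endpoints : List Edge → List ℕ
endpoints = concatMap (λ e → proj₁ e ∷ proj₂ e ∷ [])

-- F is a perfect matching of K_v: every listed edge is an edge of K_v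
-- (0 ≤ u < w < v) and each vertex 0..v-1 occurs exactly once as an endpoint
-- (so the edges are pairwise disjoint and cover all vertices).
IsPerfectMatching : ℕ → List Edge → Set
IsPerfectMatching v F =
  All (λ e → proj₁ e < proj₂ e) F × (endpoints F ↭ upTo v)

lengthList : ℕ → (ℕ → ℕ) → List ℕ
lengthList zero    a = []
lengthList (suc t) a = lengthList t a Data.List.++ replicate (a (suc t)) (suc t)

sumTo : ℕ → (ℕ → ℕ) → ℕ
sumTo zero    a = 0
sumTo (suc t) a = sumTo t a + a (suc t)

-- Call a matching of {0,…,2t−1} with ℓ'-lengths exactly 1,…,t a Skolem sequence of order t;
-- Skolem's classical construction gives one whenever t ≡ 0, 1 (mod 4). With c = a_t, the list L
-- is c copies of {1,…,t} together with the list of the a_i − c, which lives on {1,…,t−1}; the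
-- condition a_{4k+2} = a_{4k+3} = a_{4k+4} forces c = 0 whenever t ≡ 2, 3 (mod 4). So by induction
-- on t, L is realised by side-by-side translates of Skolem sequences on {0,…,2n−1}. All lengths
-- are at most t ≤ n, so ℓ and ℓ' agree on K_{2n}.
module Submission where

open import Defs
open import Data.Nat using (ℕ; zero; suc; _+_; _*_; _∸_; _≤_; _<_; _≤′_; ≤′-refl; ≤′-step; _<?_; z≤n; s≤s)
open import Data.Nat.Properties
open import Data.Nat.ListAction using (sum)
open import Data.Nat.Tactic.RingSolver using (solve-∀; solve)
open import Data.Product using (Σ; _×_; _,_; proj₁; proj₂)
open import Data.Sum using (_⊎_; inj₁; inj₂)
open import Relation.Nullary using (yes; no)
open import Data.List using (List; []; _∷_; [_]; map; _++_; replicate; concat; concatMap; upTo; applyUpTo)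
import Data.List.Properties as List
open import Data.List.Relation.Unary.All using (All)
import Data.List.Relation.Unary.All as All
import Data.List.Relation.Unary.All.Properties as All
open import Data.List.Relation.Binary.Permutation.Propositional
  using (_↭_; ↭-refl; ↭-sym; ↭-trans; ↭-reflexive; ↭-prep; module PermutationReasoning)
open import Data.List.Relation.Binary.Permutation.Propositional.Properties
  using (++⁺; ++⁺ˡ; ++⁺ʳ; map⁺; ∷↭∷ʳ; All-resp-↭; ++-commutativeMonoid)
open import Algebra.Solver.CommutativeMonoid (++-commutativeMonoid {A = ℕ})
  using (_⊜_; _⊕_; id) renaming (solve to ++-solve)
open import Relation.Binary.PropositionalEquality
  using (_≡_; refl; sym; trans; cong; cong₂; subst; module ≡-Reasoning)

private
  variable
    V V′ W L L′ M : List ℕ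

range : ℕ → ℕ → List ℕ
range a zero    = []
range a (suc k) = a ∷ range (suc a) k

range-++ : ∀ a m k → range a (m + k) ≡ range a m ++ range (a + m) k
range-++ a zero    k = cong (λ b → range b k) (sym (+-identityʳ a))
range-++ a (suc m) k = cong (a ∷_) (trans (range-++ (suc a) m k)
  (cong (λ b → range (suc a) m ++ range b k) (sym (+-suc a m))))

map-+-range : ∀ o a k → map (o +_) (range a k) ≡ range (o + a) k
map-+-range o a zero    = refl
map-+-range o a (suc k) =
  cong (o + a ∷_) (trans (map-+-range o (suc a) k) (cong (λ b → range b k) (+-suc o a)))

upTo≡range : ∀ k → upTo k ≡ range 0 k
upTo≡range zero    = refl
upTo≡range (suc k) = cong (0 ∷_) (begin
  applyUpTo suc k      ≡⟨ List.map-upTo suc k ⟨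
  map suc (upTo k)     ≡⟨ cong (map suc) (upTo≡range k) ⟩
  map suc (range 0 k)  ≡⟨ map-+-range 1 0 k ⟩
  range 1 k            ∎)
  where open ≡-Reasoning

Tiling : ℕ → List (ℕ × ℕ) → ℕ → Set
Tiling a []              n = a ≡ n
Tiling a ((b , k) ∷ ivs) n = b ≡ a × Tiling (a + k) ivs n

interval : ℕ × ℕ → List ℕ
interval (b , k) = range b k

intervals : List (ℕ × ℕ) → List ℕ
intervals = concatMap interval

tiling-intervals : ∀ a ivs n → Tiling a ivs n → range 0 a ++ intervals ivs ≡ range 0 n
tiling-intervals a []              n refl        = List.++-identityʳ (range 0 a)
tiling-intervals a ((b , k) ∷ ivs) n (refl , ts) = begin
  range 0 a ++ (range a k ++ intervals ivs)  ≡⟨ List.++-assoc (range 0 a) _ _ ⟨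
  (range 0 a ++ range a k) ++ intervals ivs  ≡⟨ cong (_++ intervals ivs) (range-++ 0 a k) ⟨
  range 0 (a + k) ++ intervals ivs           ≡⟨ tiling-intervals (a + k) ivs n ts ⟩
  range 0 n                                  ∎
  where open ≡-Reasoning

record Matching (V L : List ℕ) : Set where
  field
    edges      : List Edge
    increasing : All (λ e → proj₁ e < proj₂ e) edges
    covers     : endpoints edges ↭ V
    lengths    : map len' edges ↭ L

open Matching

∅ : Matching [] []
∅ = record { edges = [] ; increasing = All.[] ; covers = ↭-refl ; lengths = ↭-refl }

_∪_ : Matching V L → Matching W M → Matching (V ++ W) (L ++ M)
F ∪ G = record
  { edges      = edges F ++ edges G
  ; increasing = All.++⁺ (increasing F) (increasing G)
  ; covers     = ↭-trans (↭-reflexive (List.concatMap-++ _ (edges F) (edges G)))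
                         (++⁺ (covers F) (covers G))
  ; lengths    = ↭-trans (↭-reflexive (List.map-++ len' (edges F) (edges G)))
                         (++⁺ (lengths F) (lengths G))
  }

reindex : V ↭ V′ → L ↭ L′ → Matching V L → Matching V′ L′
reindex V↭V′ L↭L′ F = record
  { edges      = edges F
  ; increasing = increasing F
  ; covers     = ↭-trans (covers F) V↭V′
  ; lengths    = ↭-trans (lengths F) L↭L′
  }

translateEdge : ℕ → Edge → Edge
translateEdge o (u , w) = (o + u , o + w)

translate : ∀ o → Matching V L → Matching (map (o +_) V) L
translate o F = record
  { edges      = map (translateEdge o) (edges F)
  ; increasing = All.map⁺ (All.map (+-monoʳ-< o) (increasing F))
  ; covers     = ↭-trans (↭-reflexive (endpoints-translate (edges F))) (map⁺ (o +_) (covers F))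
  ; lengths    = ↭-trans (↭-reflexive (lengths-translate (edges F))) (lengths F)
  }
  where
  endpoints-translate : ∀ es → endpoints (map (translateEdge o) es) ≡ map (o +_) (endpoints es)
  endpoints-translate []             = refl
  endpoints-translate ((u , w) ∷ es) = cong (λ vs → o + u ∷ o + w ∷ vs) (endpoints-translate es)

  lengths-translate : ∀ es → map len' (map (translateEdge o) es) ≡ map len' es
  lengths-translate []             = refl
  lengths-translate ((u , w) ∷ es) = cong₂ _∷_ ([m+n]∸[m+o]≡n∸o o w u) (lengths-translate es)

nestedLengths : ℕ → ℕ → List ℕ
nestedLengths zero    g = []
nestedLengths (suc k) g = g + (1 + 2 * k) ∷ nestedLengths k g

-- k nested edges {x + i, x + 2k − 1 + g − i}, i < k, around a gap of g vertices.
nested : ∀ x k g → Matching (range x k ++ range (x + k + g) k) (nestedLengths k g)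
nested x zero    g = ∅
nested x (suc k) g = record
  { edges      = (x , x + d) ∷ edges inner
  ; increasing = m<m+n x (≤-trans (s≤s z≤n) (m≤n+m _ g)) All.∷ increasing inner
  ; covers     = ↭-prep x covers′
  ; lengths    = ↭-trans (↭-reflexive (cong (_∷ map len' (edges inner)) (m+n∸m≡n x d))) (↭-prep d (lengths inner))
  }
  where
  d : ℕ
  d = g + (1 + 2 * k)
  inner : Matching (range (suc x) k ++ range (suc x + k + g) k) (nestedLengths k g)
  inner = nested (suc x) k g
  shift-start : ∀ x k g → suc x + k + g ≡ x + suc k + g
  shift-start = solve-∀
  edge-end : ∀ x k g → x + (g + (1 + 2 * k)) ≡ x + suc k + g + k
  edge-end = solve-∀
  covers′ : x + d ∷ endpoints (edges inner) ↭ range (suc x) k ++ range (x + suc k + g) (suc k)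
  covers′ = begin
    x + d ∷ endpoints (edges inner)
      ↭⟨ ↭-prep (x + d) (covers inner) ⟩
    x + d ∷ (range (suc x) k ++ range (suc x + k + g) k)
      ↭⟨ ∷↭∷ʳ (x + d) _ ⟩
    (range (suc x) k ++ range (suc x + k + g) k) ++ [ x + d ]
      ≡⟨ List.++-assoc (range (suc x) k) _ _ ⟩
    range (suc x) k ++ (range (suc x + k + g) k ++ range (x + d) 1)
      ≡⟨ cong₂ (λ b c → range (suc x) k ++ (range b k ++ range c 1)) (shift-start x k g) (edge-end x k g) ⟩
    range (suc x) k ++ (range (x + suc k + g) k ++ range (x + suc k + g + k) 1)
      ≡⟨ cong (range (suc x) k ++_) (range-++ (x + suc k + g) k 1) ⟨
    range (suc x) k ++ range (x + suc k + g) (k + 1)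
      ≡⟨ cong (λ j → range (suc x) k ++ range (x + suc k + g) j) (+-comm k 1) ⟩
    range (suc x) k ++ range (x + suc k + g) (suc k) ∎
    where open PermutationReasoning

nestedLengths-+ : ∀ j k g → nestedLengths (j + k) g ≡ nestedLengths j (g + 2 * k) ++ nestedLengths k g
nestedLengths-+ zero    k g = refl
nestedLengths-+ (suc j) k g = cong₂ _∷_ (shuffle g j k) (nestedLengths-+ j k g)
  where
  shuffle : ∀ g j k → g + (1 + 2 * (j + k)) ≡ g + 2 * k + (1 + 2 * j)
  shuffle = solve-∀

nestedLengths-∷ʳ : ∀ k g → nestedLengths (suc k) g ≡ nestedLengths k (2 + g) ++ [ 1 + g ]
nestedLengths-∷ʳ k g = begin
  nestedLengths (suc k) g                          ≡⟨ cong (λ j → nestedLengths j g) (+-comm 1 k) ⟩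
  nestedLengths (k + 1) g                          ≡⟨ nestedLengths-+ k 1 g ⟩
  nestedLengths k (g + 2) ++ [ g + 1 ]             ≡⟨ cong₂ (λ h l → nestedLengths k h ++ [ l ]) (+-comm g 2) (+-comm g 1) ⟩
  nestedLengths k (2 + g) ++ [ 1 + g ]             ∎
  where open ≡-Reasoning

range-odd-even : ∀ q → range 1 (2 * q) ↭ nestedLengths q 0 ++ nestedLengths q 1
range-odd-even zero    = ↭-refl
range-odd-even (suc q) = begin
  range 1 (2 * suc q)
    ≡⟨ cong (range 1) (*-suc 2 q) ⟩
  range 1 (2 + 2 * q)
    ≡⟨ cong (range 1) (+-comm 2 (2 * q)) ⟩
  range 1 (2 * q + 2)
    ≡⟨ range-++ 1 (2 * q) 2 ⟩
  range 1 (2 * q) ++ (1 + 2 * q ∷ 2 + 2 * q ∷ [])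
    ↭⟨ ++⁺ʳ _ (range-odd-even q) ⟩
  (nestedLengths q 0 ++ nestedLengths q 1) ++ ([ 1 + 2 * q ] ++ [ 2 + 2 * q ])
    ↭⟨ ++-solve 4 (λ o e x y → (o ⊕ e) ⊕ (x ⊕ y) ⊜ (x ⊕ o) ⊕ (y ⊕ e)) ↭-refl
        (nestedLengths q 0) (nestedLengths q 1) [ 1 + 2 * q ] [ 2 + 2 * q ] ⟩
  (1 + 2 * q ∷ nestedLengths q 0) ++ (2 + 2 * q ∷ nestedLengths q 1) ∎
  where open PermutationReasoning

range-odd-even-halves : ∀ m → range 1 (4 * m) ↭
  (nestedLengths m (2 * m) ++ nestedLengths m 0) ++ (nestedLengths m (1 + 2 * m) ++ nestedLengths m 1)
range-odd-even-halves m = begin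
  range 1 (4 * m)                                     ≡⟨ cong (range 1) (four-m m) ⟨
  range 1 (2 * (m + m))                               ↭⟨ range-odd-even (m + m) ⟩
  nestedLengths (m + m) 0 ++ nestedLengths (m + m) 1  ≡⟨ cong₂ _++_ (nestedLengths-+ m m 0) (nestedLengths-+ m m 1) ⟩
  (nestedLengths m (2 * m) ++ nestedLengths m 0) ++ (nestedLengths m (1 + 2 * m) ++ nestedLengths m 1) ∎
  where
  open PermutationReasoning
  four-m : ∀ m → 2 * (m + m) ≡ 4 * m
  four-m = solve-∀

Shell : Set
Shell = ℕ × ℕ × ℕ

lower upper : Shell → ℕ × ℕ
lower (x , k , g) = (x , k)
upper (x , k , g) = (x + k + g , k)

shellVertices : Shell → List ℕ
shellVertices s = interval (lower s) ++ interval (upper s)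

shellLengths : Shell → List ℕ
shellLengths (x , k , g) = nestedLengths k g

shells : ∀ ss → Matching (concatMap shellVertices ss) (concatMap shellLengths ss)
shells []                 = ∅
shells ((x , k , g) ∷ ss) = nested x k g ∪ shells ss

-- A Skolem sequence of order 4(p + 1) + e, e ∈ {0, 1}, as six families of nested edges.
module SkolemConstruction (p e : ℕ) where
  s₁ s₂ s₃ s₄ s₅ s₆ : Shell
  s₁ = (0 , suc p , 1 + 2 * suc p)
  s₂ = (suc p , suc p , 0)
  s₃ = (3 * suc p , 1 , 2 * e + (4 * p + 2))
  s₄ = (4 * suc p + 1 , p , 2 * e + 2 * suc p)
  s₅ = (5 * suc p , e + p , 1)
  s₆ = (e + (6 * p + 5) , 1 , e + (2 * p + 1))

  skolemShells : List Shell
  skolemShells = s₁ ∷ s₂ ∷ s₃ ∷ s₄ ∷ s₅ ∷ s₆ ∷ []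

  -- lower s₁, lower s₂, upper s₂, lower s₃, upper s₁, lower s₄,
  -- lower s₅, lower s₆, upper s₅, upper s₃, upper s₄, upper s₆
  sorted : List (ℕ × ℕ)
  sorted =
    (0 , suc p) ∷ (suc p , suc p) ∷ (suc p + suc p + 0 , suc p) ∷ (3 * suc p , 1) ∷
    (0 + suc p + (1 + 2 * suc p) , suc p) ∷ (4 * suc p + 1 , p) ∷
    (5 * suc p , e + p) ∷ (e + (6 * p + 5) , 1) ∷ (5 * suc p + (e + p) + 1 , e + p) ∷
    (3 * suc p + 1 + (2 * e + (4 * p + 2)) , 1) ∷ (4 * suc p + 1 + p + (2 * e + 2 * suc p) , p) ∷
    (e + (6 * p + 5) + 1 + (e + (2 * p + 1)) , 1) ∷ []

  tiling : Tiling 0 sorted (2 * (4 * suc p + e))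
  tiling = refl , refl , solve (p ∷ e ∷ []) , solve (p ∷ e ∷ []) , solve (p ∷ e ∷ []) , solve (p ∷ e ∷ []) ,
           solve (p ∷ e ∷ []) , solve (p ∷ e ∷ []) , solve (p ∷ e ∷ []) , solve (p ∷ e ∷ []) ,
           solve (p ∷ e ∷ []) , solve (p ∷ e ∷ []) , solve (p ∷ e ∷ [])

  vertices : concatMap shellVertices skolemShells ↭ range 0 (2 * (4 * suc p + e))
  vertices = begin
    concatMap shellVertices skolemShells
      ↭⟨ ++-solve 12 (λ l₁ u₁ l₂ u₂ l₃ u₃ l₄ u₄ l₅ u₅ l₆ u₆ →
           (l₁ ⊕ u₁) ⊕ ((l₂ ⊕ u₂) ⊕ ((l₃ ⊕ u₃) ⊕ ((l₄ ⊕ u₄) ⊕ ((l₅ ⊕ u₅) ⊕ ((l₆ ⊕ u₆) ⊕ id)))))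
           ⊜ l₁ ⊕ (l₂ ⊕ (u₂ ⊕ (l₃ ⊕ (u₁ ⊕ (l₄ ⊕ (l₅ ⊕ (l₆ ⊕ (u₅ ⊕ (u₃ ⊕ (u₄ ⊕ (u₆ ⊕ id))))))))))))
           ↭-refl (lo s₁) (up s₁) (lo s₂) (up s₂) (lo s₃) (up s₃)
                  (lo s₄) (up s₄) (lo s₅) (up s₅) (lo s₆) (up s₆) ⟩
    intervals sorted
      ≡⟨ tiling-intervals 0 sorted _ tiling ⟩
    range 0 (2 * (4 * suc p + e)) ∎
    where
    open PermutationReasoning
    lo up : Shell → List ℕ
    lo s = interval (lower s)
    up s = interval (upper s)

Skolem : ℕ → Set
Skolem t = Matching (range 0 (2 * t)) (range 1 t)

skolem-4k : ∀ k → Skolem (4 * k)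
skolem-4k zero    = ∅
skolem-4k (suc p) =
  reindex (↭-trans vertices (↭-reflexive (cong (λ t → range 0 (2 * t)) (+-identityʳ (4 * suc p)))))
          lengths′ (shells skolemShells)
  where
  open SkolemConstruction p 0
  m : ℕ
  m = suc p
  top-odd : ∀ p → 4 * p + 2 + 1 ≡ 2 * suc p + (1 + 2 * p)
  top-odd = solve-∀
  middle-even : ∀ p → 2 * p + 1 + 1 ≡ 1 + (1 + 2 * p)
  middle-even = solve-∀
  -- s₃, s₄, s₂ give the odd lengths 4m − 1, 4m − 3 … 2m + 1, 2m − 1 … 1;
  -- s₁, s₆, s₅ the even ones 4m … 2m + 2, 2m, 2m − 2 … 2.
  lengths′ : concatMap shellLengths skolemShells ↭ range 1 (4 * m)
  lengths′ = begin
    concatMap shellLengths skolemShells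
      ↭⟨ ++-solve 6 (λ l₁ l₂ l₃ l₄ l₅ l₆ →
           l₁ ⊕ (l₂ ⊕ (l₃ ⊕ (l₄ ⊕ (l₅ ⊕ (l₆ ⊕ id))))) ⊜ ((l₃ ⊕ l₄) ⊕ l₂) ⊕ (l₁ ⊕ (l₆ ⊕ l₅)))
           ↭-refl (shellLengths s₁) (shellLengths s₂) (shellLengths s₃)
                  (shellLengths s₄) (shellLengths s₅) (shellLengths s₆) ⟩
    ((4 * p + 2 + 1 ∷ nestedLengths p (2 * m)) ++ nestedLengths m 0) ++
      (nestedLengths m (1 + 2 * m) ++ (2 * p + 1 + 1 ∷ nestedLengths p 1))
      ≡⟨ cong₂ (λ u v → ((u ∷ nestedLengths p (2 * m)) ++ nestedLengths m 0) ++
                          (nestedLengths m (1 + 2 * m) ++ (v ∷ nestedLengths p 1)))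
               (top-odd p) (middle-even p) ⟩
    (nestedLengths m (2 * m) ++ nestedLengths m 0) ++ (nestedLengths m (1 + 2 * m) ++ nestedLengths m 1)
      ↭⟨ range-odd-even-halves m ⟨
    range 1 (4 * m) ∎
    where open PermutationReasoning

skolem-4k+1 : ∀ k → Skolem (4 * k + 1)
skolem-4k+1 zero    = nested 0 1 0
skolem-4k+1 (suc p) = reindex vertices lengths′ (shells skolemShells)
  where
  open SkolemConstruction p 1
  m : ℕ
  m = suc p
  top : ∀ p → 2 + (4 * p + 2) + 1 ≡ 1 + 4 * suc p
  top = solve-∀
  middle-odd : ∀ p → 1 + (2 * p + 1) + 1 ≡ 1 + 2 * suc p
  middle-odd = solve-∀
  -- s₄, s₆, s₂ give the odd lengths 4m − 1 … 2m + 3, 2m + 1, 2m − 1 … 1;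
  -- s₁, s₅ the even ones 4m … 2m + 2, 2m … 2; and s₃ gives 4m + 1.
  lengths′ : concatMap shellLengths skolemShells ↭ range 1 (4 * m + 1)
  lengths′ = begin
    concatMap shellLengths skolemShells
      ↭⟨ ++-solve 6 (λ l₁ l₂ l₃ l₄ l₅ l₆ →
           l₁ ⊕ (l₂ ⊕ (l₃ ⊕ (l₄ ⊕ (l₅ ⊕ (l₆ ⊕ id))))) ⊜ (((l₄ ⊕ l₆) ⊕ l₂) ⊕ (l₁ ⊕ l₅)) ⊕ l₃)
           ↭-refl (shellLengths s₁) (shellLengths s₂) (shellLengths s₃)
                  (shellLengths s₄) (shellLengths s₅) (shellLengths s₆) ⟩
    (((nestedLengths p (2 + 2 * m) ++ [ 1 + (2 * p + 1) + 1 ]) ++ nestedLengths m 0) ++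
      (nestedLengths m (1 + 2 * m) ++ nestedLengths m 1)) ++ [ 2 + (4 * p + 2) + 1 ]
      ≡⟨ cong₂ (λ u v → (((nestedLengths p (2 + 2 * m) ++ [ u ]) ++ nestedLengths m 0) ++
                          (nestedLengths m (1 + 2 * m) ++ nestedLengths m 1)) ++ [ v ])
               (middle-odd p) (top p) ⟩
    (((nestedLengths p (2 + 2 * m) ++ [ 1 + 2 * m ]) ++ nestedLengths m 0) ++
      (nestedLengths m (1 + 2 * m) ++ nestedLengths m 1)) ++ [ 1 + 4 * m ]
      ≡⟨ cong (λ xs → ((xs ++ nestedLengths m 0) ++ (nestedLengths m (1 + 2 * m) ++ nestedLengths m 1)) ++ [ 1 + 4 * m ])
              (nestedLengths-∷ʳ p (2 * m)) ⟨
    ((nestedLengths m (2 * m) ++ nestedLengths m 0) ++ (nestedLengths m (1 + 2 * m) ++ nestedLengths m 1)) ++ [ 1 + 4 * m ]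
      ↭⟨ ++⁺ʳ _ (range-odd-even-halves m) ⟨
    range 1 (4 * m) ++ range (1 + 4 * m) 1
      ≡⟨ range-++ 1 (4 * m) 1 ⟨
    range 1 (4 * m + 1) ∎
    where open PermutationReasoning

copies : ∀ {t} → Skolem t → ∀ c o → Matching (range o (c * (2 * t))) (concat (replicate c (range 1 t)))
copies     S zero    o = ∅
copies {t} S (suc c) o = reindex (↭-reflexive vertices) ↭-refl (translate o S ∪ copies S c (o + 2 * t))
  where
  vertices : map (o +_) (range 0 (2 * t)) ++ range (o + 2 * t) (c * (2 * t)) ≡ range o (suc c * (2 * t))
  vertices = begin
    map (o +_) (range 0 (2 * t)) ++ rest  ≡⟨ cong (_++ rest) (map-+-range o 0 (2 * t)) ⟩
    range (o + 0) (2 * t) ++ rest         ≡⟨ cong (λ b → range b (2 * t) ++ rest) (+-identityʳ o) ⟩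
    range o (2 * t) ++ rest               ≡⟨ range-++ o (2 * t) (c * (2 * t)) ⟨
    range o (2 * t + c * (2 * t))         ∎
    where
    open ≡-Reasoning
    rest : List ℕ
    rest = range (o + 2 * t) (c * (2 * t))

layer : ∀ {t} c o → c ≡ 0 ⊎ Skolem t → Matching (range o (c * (2 * t))) (concat (replicate c (range 1 t)))
layer c o (inj₁ refl) = ∅
layer c o (inj₂ S)    = copies S c o

replicate-+ : ∀ m n (x : ℕ) → replicate (m + n) x ≡ replicate m x ++ replicate n x
replicate-+ zero    n x = refl
replicate-+ (suc m) n x = cong (x ∷_) (replicate-+ m n x)

concat-replicate-[] : ∀ c → concat (replicate c []) ≡ List.[] {A = ℕ}
concat-replicate-[] zero    = refl
concat-replicate-[] (suc c) = concat-replicate-[] c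

concat-replicate-∷ʳ : ∀ c (R : List ℕ) x → concat (replicate c (R ++ [ x ])) ↭ concat (replicate c R) ++ replicate c x
concat-replicate-∷ʳ zero    R x = ↭-refl
concat-replicate-∷ʳ (suc c) R x = begin
  (R ++ [ x ]) ++ concat (replicate c (R ++ [ x ]))
    ↭⟨ ++⁺ˡ (R ++ [ x ]) (concat-replicate-∷ʳ c R x) ⟩
  (R ++ [ x ]) ++ (concat (replicate c R) ++ replicate c x)
    ↭⟨ ++-solve 4 (λ r x′ rs xs → (r ⊕ x′) ⊕ (rs ⊕ xs) ⊜ (r ⊕ rs) ⊕ (x′ ⊕ xs)) ↭-refl
         R [ x ] (concat (replicate c R)) (replicate c x) ⟩
  (R ++ concat (replicate c R)) ++ (x ∷ replicate c x) ∎
  where open PermutationReasoning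

range-1-suc : ∀ t → range 1 (suc t) ≡ range 1 t ++ [ suc t ]
range-1-suc t = trans (cong (range 1) (+-comm 1 t)) (range-++ 1 t 1)

lengthList-peel : ∀ t a b c → (∀ i → 1 ≤ i → i ≤ t → a i ≡ b i + c) →
                  lengthList t a ↭ lengthList t b ++ concat (replicate c (range 1 t))
lengthList-peel zero    a b c h = ↭-reflexive (sym (concat-replicate-[] c))
lengthList-peel (suc t) a b c h = begin
  lengthList t a ++ replicate (a (suc t)) (suc t)
    ↭⟨ ++⁺ (lengthList-peel t a b c (λ i 1≤i i≤t → h i 1≤i (m≤n⇒m≤1+n i≤t)))
           (↭-reflexive (trans (cong (λ k → replicate k (suc t)) (h (suc t) (s≤s z≤n) ≤-refl))
                               (replicate-+ (b (suc t)) c (suc t)))) ⟩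
  (lengthList t b ++ R) ++ (replicate (b (suc t)) (suc t) ++ replicate c (suc t))
    ↭⟨ ++-solve 4 (λ l r x y → (l ⊕ r) ⊕ (x ⊕ y) ⊜ (l ⊕ x) ⊕ (r ⊕ y)) ↭-refl
         (lengthList t b) R (replicate (b (suc t)) (suc t)) (replicate c (suc t)) ⟩
  lengthList (suc t) b ++ (R ++ replicate c (suc t))
    ↭⟨ ++⁺ˡ (lengthList (suc t) b) (concat-replicate-∷ʳ c (range 1 t) (suc t)) ⟨
  lengthList (suc t) b ++ concat (replicate c (range 1 t ++ [ suc t ]))
    ≡⟨ cong (λ r → lengthList (suc t) b ++ concat (replicate c r)) (range-1-suc t) ⟨
  lengthList (suc t) b ++ concat (replicate c (range 1 (suc t))) ∎
  where
  open PermutationReasoning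
  R : List ℕ
  R = concat (replicate c (range 1 t))

sumTo-peel : ∀ t a b c → (∀ i → 1 ≤ i → i ≤ t → a i ≡ b i + c) → sumTo t a ≡ sumTo t b + t * c
sumTo-peel zero    a b c h = refl
sumTo-peel (suc t) a b c h = begin
  sumTo t a + a (suc t)
    ≡⟨ cong₂ _+_ (sumTo-peel t a b c (λ i 1≤i i≤t → h i 1≤i (m≤n⇒m≤1+n i≤t))) (h (suc t) (s≤s z≤n) ≤-refl) ⟩
  (sumTo t b + t * c) + (b (suc t) + c)
    ≡⟨ shuffle (sumTo t b) (t * c) (b (suc t)) c ⟩
  (sumTo t b + b (suc t)) + (c + t * c) ∎
  where
  open ≡-Reasoning
  shuffle : ∀ w x y z → (w + x) + (y + z) ≡ (w + y) + (z + x)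
  shuffle = solve-∀

VanishesAbove : ℕ → (ℕ → ℕ) → Set
VanishesAbove t a = ∀ i → t < i → a i ≡ 0

NonIncreasing : (ℕ → ℕ) → Set
NonIncreasing a = ∀ i → 1 ≤ i → a (suc i) ≤ a i

ConstantOnBlocks : (ℕ → ℕ) → Set
ConstantOnBlocks a = ∀ k → a (4 * k + 2) ≡ a (4 * k + 3) × a (4 * k + 3) ≡ a (4 * k + 4)

nonIncreasing⇒≥ : ∀ {a i j} → NonIncreasing a → 1 ≤ i → i ≤′ j → a j ≤ a i
nonIncreasing⇒≥ mono 1≤i ≤′-refl      = ≤-refl
nonIncreasing⇒≥ mono 1≤i (≤′-step i≤j) =
  ≤-trans (mono _ (≤-trans 1≤i (≤′⇒≤ i≤j))) (nonIncreasing⇒≥ mono 1≤i i≤j)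

vanishesAbove-∸-last : ∀ {t a} → VanishesAbove (suc t) a → VanishesAbove t (λ i → a i ∸ a (suc t))
vanishesAbove-∸-last {t} {a} zeros i t<i with m≤n⇒m<n∨m≡n t<i
... | inj₁ t+1<i = trans (cong (_∸ a (suc t)) (zeros i t+1<i)) (0∸n≡0 (a (suc t)))
... | inj₂ refl  = n∸n≡0 (a (suc t))

nonIncreasing-∸ : ∀ {a} c → NonIncreasing a → NonIncreasing (λ i → a i ∸ c)
nonIncreasing-∸ c mono i 1≤i = ∸-monoˡ-≤ c (mono i 1≤i)

constantOnBlocks-∘ : ∀ {a} (f : ℕ → ℕ) → ConstantOnBlocks a → ConstantOnBlocks (λ i → f (a i))
constantOnBlocks-∘ f blocks k = cong f (proj₁ (blocks k)) , cong f (proj₂ (blocks k))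

data Mod4 : ℕ → Set where
  4k   : ∀ k → Mod4 (4 * k)
  4k+1 : ∀ k → Mod4 (4 * k + 1)
  4k+2 : ∀ k → Mod4 (4 * k + 2)
  4k+3 : ∀ k → Mod4 (4 * k + 3)

mod4 : ∀ n → Mod4 n
mod4 zero = 4k 0
mod4 (suc n) with mod4 n
... | 4k k   = subst Mod4 (+-comm (4 * k) 1) (4k+1 k)
... | 4k+1 k = subst Mod4 (+-suc (4 * k) 1) (4k+2 k)
... | 4k+2 k = subst Mod4 (+-suc (4 * k) 2) (4k+3 k)
... | 4k+3 k = subst Mod4 (wrap k) (4k (suc k))
  where
  wrap : ∀ k → 4 * suc k ≡ suc (4 * k + 3)
  wrap = solve-∀

vanishes-or-skolem : ∀ {a t} → Mod4 t → VanishesAbove t a → ConstantOnBlocks a → a t ≡ 0 ⊎ Skolem t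
vanishes-or-skolem (4k k)   _     _      = inj₂ (skolem-4k k)
vanishes-or-skolem (4k+1 k) _     _      = inj₂ (skolem-4k+1 k)
vanishes-or-skolem (4k+2 k) zeros blocks = inj₁ (trans (proj₁ (blocks k)) (zeros _ (+-monoʳ-< (4 * k) (n<1+n 2))))
vanishes-or-skolem (4k+3 k) zeros blocks = inj₁ (trans (proj₂ (blocks k)) (zeros _ (+-monoʳ-< (4 * k) (n<1+n 3))))

layered : ∀ t a → VanishesAbove t a → NonIncreasing a → ConstantOnBlocks a →
          Matching (range 0 (2 * sumTo t a)) (lengthList t a)
layered zero    a _     _    _      = ∅
layered (suc t) a zeros mono blocks =
  reindex (↭-reflexive vertices) (↭-sym lengths′)
    (layered t b (vanishesAbove-∸-last zeros) (nonIncreasing-∸ c mono) (constantOnBlocks-∘ {a} (_∸ c) blocks)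
     ∪ layer c (2 * sumTo t b) (vanishes-or-skolem (mod4 (suc t)) zeros blocks))
  where
  c : ℕ
  c = a (suc t)

  b : ℕ → ℕ
  b i = a i ∸ c

  peel : ∀ i → 1 ≤ i → i ≤ suc t → a i ≡ b i + c
  peel i 1≤i i≤t = sym (m∸n+n≡m (nonIncreasing⇒≥ mono 1≤i (≤⇒≤′ i≤t)))

  top-zero : b (suc t) ≡ 0
  top-zero = n∸n≡0 c

  twice-sum : 2 * sumTo (suc t) a ≡ 2 * sumTo t b + c * (2 * suc t)
  twice-sum = begin
    2 * sumTo (suc t) a                         ≡⟨ cong (2 *_) (sumTo-peel (suc t) a b c peel) ⟩
    2 * (sumTo t b + b (suc t) + suc t * c)     ≡⟨ cong (λ z → 2 * (sumTo t b + z + suc t * c)) top-zero ⟩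
    2 * (sumTo t b + 0 + suc t * c)             ≡⟨ arith (sumTo t b) t c ⟩
    2 * sumTo t b + c * (2 * suc t)             ∎
    where
    open ≡-Reasoning
    arith : ∀ s t c → 2 * (s + 0 + suc t * c) ≡ 2 * s + c * (2 * suc t)
    arith = solve-∀

  vertices : range 0 (2 * sumTo t b) ++ range (2 * sumTo t b) (c * (2 * suc t)) ≡ range 0 (2 * sumTo (suc t) a)
  vertices = trans (sym (range-++ 0 (2 * sumTo t b) (c * (2 * suc t)))) (cong (range 0) (sym twice-sum))

  lengths′ : lengthList (suc t) a ↭ lengthList t b ++ concat (replicate c (range 1 (suc t)))
  lengths′ = begin
    lengthList (suc t) a                                            ↭⟨ lengthList-peel (suc t) a b c peel ⟩
    (lengthList t b ++ replicate (b (suc t)) (suc t)) ++ R          ≡⟨ cong (λ k → (lengthList t b ++ replicate k (suc t)) ++ R) top-zero ⟩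
    (lengthList t b ++ []) ++ R                                     ≡⟨ cong (_++ R) (List.++-identityʳ (lengthList t b)) ⟩
    lengthList t b ++ R                                             ∎
    where
    open PermutationReasoning
    R : List ℕ
    R = concat (replicate c (range 1 (suc t)))

lengthList-bounded : ∀ t a → All (_≤ t) (lengthList t a)
lengthList-bounded zero    a = All.[]
lengthList-bounded (suc t) a =
  All.++⁺ (All.map m≤n⇒m≤1+n (lengthList-bounded t a)) (All.replicate⁺ (a (suc t)) ≤-refl)

len≡len' : ∀ n e → len' e ≤ n → len (2 * n) e ≡ len' e
len≡len' n (u , w) d≤n = m≤n⇒m⊓n≡m (m+n≤o⇒m≤o∸n (w ∸ u) (begin
  (w ∸ u) + (w ∸ u)  ≤⟨ +-mono-≤ d≤n d≤n ⟩
  n + n              ≡⟨ cong (n +_) (+-identityʳ n) ⟨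
  2 * n              ∎))
  where open ≤-Reasoning

nonIncreasing-extend : ∀ t a → VanishesAbove t a → (∀ i → 1 ≤ i → i < t → a (i + 1) ≤ a i) → NonIncreasing a
nonIncreasing-extend t a zeros mono i 1≤i with i <? t
... | yes i<t = subst (λ j → a j ≤ a i) (+-comm i 1) (mono i 1≤i i<t)
... | no  i≮t = subst (_≤ a i) (sym (zeros (suc i) (s≤s (≮⇒≥ i≮t)))) z≤n

corollary4p2 : (t n : ℕ) (a : ℕ → ℕ) →
    1 ≤ t → t ≤ n →
    (∀ i → t < i → a i ≡ 0) →
    sumTo t a ≡ n →
    (∀ i → 1 ≤ i → i < t → a (i + 1) ≤ a i) →
    (∀ i → 1 ≤ i → i ≤ t → 1 ≤ a i) →
    (∀ k → a (4 * k + 2) ≡ a (4 * k + 3) × a (4 * k + 3) ≡ a (4 * k + 4)) →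
    Σ (List Edge) (λ F → IsPerfectMatching (2 * n) F
      × (map (len (2 * n)) F ↭ lengthList t a)
      × (map len' F ↭ lengthList t a))
corollary4p2 t n a _ t≤n zeros refl mono _ blocks =
  edges F , (increasing F , covers′) , ↭-trans (↭-reflexive ℓ≡ℓ') (lengths F) , lengths F
  where
  F : Matching (range 0 (2 * sumTo t a)) (lengthList t a)
  F = layered t a zeros (nonIncreasing-extend t a zeros mono) blocks

  covers′ : endpoints (edges F) ↭ upTo (2 * sumTo t a)
  covers′ = ↭-trans (covers F) (↭-reflexive (sym (upTo≡range (2 * sumTo t a))))

  short : All (λ e → len' e ≤ sumTo t a) (edges F)
  short = All.map⁻ (All-resp-↭ (↭-sym (lengths F)) (All.map (λ i≤t → ≤-trans i≤t t≤n) (lengthList-bounded t a)))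

  ℓ≡ℓ' : map (len (2 * sumTo t a)) (edges F) ≡ map len' (edges F)
  ℓ≡ℓ' = List.map-cong-local (All.map (λ {e} → len≡len' (sumTo t a) e) short)
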